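{- Let $P_n$ be the undirected path graph on $n$ vertices. There exists a valuation $f$ of $P_n$ such that $T(P_n,f)=\Omega(n^2)$. Consequently $\mathcal{T}(P_n)=\Theta(n^2)$, i.e., there are constants $c,C>0$ with $c\,n^2\le\mathcal{T}(P_n)\le C\,n^2$ for all sufficiently large $n$.
   Context: Let $G=(V,E)$ be a finite simple graph with $n=|V|$ vertices and write $[n]=\{1,\dots,n\}$. A valuation is a function $f:V\to[n]$. The asynchronous maximum model is the following discrete-time random process on valuations: given the current valuation $f_t$, choose a vertex $v'\in V$ uniformly at random, independently of the past; set $f_{t+1}(v')=\max\{f_t(u): u\neq v',\ u \text{ adjacent to } v'\}$ if $v'$ has at least one neighbour, and $f_{t+1}(v')=f_t(v')$ otherwise; and $f_{t+1}(v)=f_t(v)$ for $v\neq v'$. Each step is a round. The Markov chain of possibilities is the directed graph (loops allowed) whose vertices are all valuations, with an edge $f\to g$ whenever the one-round transition probability from $f$ to $g$ is positive; its absorbing components are the maximal strongly connected components with no edge leaving them. For a valuation $f$, let $Y_f$ be the number of rounds until the process started at $f_0=f$ first reaches a valuation in an absorbing component, $T(G,f)=\mathbb{E}[Y_f]$, and $\mathcal{T}(G)=\max_f T(G,f)$ over all valuations $f:V\to[n]$. -}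

module Defs where

open import Data.Bool using (Bool; true; false; _∨_; _∧_; not; if_then_else_)
open import Data.Nat using (ℕ; zero; suc; _^_; _≡ᵇ_) renaming (_+_ to _+ℕ_)
open import Data.Fin using (Fin; zero; suc; toℕ)
open import Data.Fin.Properties using (_≟_; _≤?_)
open import Data.List using (List; []; _∷_; map; concatMap; foldr)
open import Data.Bool.ListAction using (all; any)
open import Data.List using () renaming (allFin to allFinL)
open import Data.Maybe using (Maybe; just; nothing)
open import Data.Integer using (+_)
open import Data.Rational using (ℚ; 0ℚ; 1ℚ; _/_; _+_; _*_)
open import Relation.Nullary.Decidable using (⌊_⌋)
open import Relation.Binary.PropositionalEquality using (_≡_; refl)
open import Data.Bool.Properties using (∨-comm)

record Graph (n : ℕ) : Set where
  field
    adj   : Fin n → Fin n → Bool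
    symm  : ∀ u v → adj u v ≡ adj v u
    loopless : ∀ v → adj v v ≡ false

-- Valuations f : V → [n]; [n] = {1..n} is represented by Fin n = {0..n-1}
-- (an order-preserving relabelling, irrelevant for the max dynamics).
Val : ℕ → Set
Val n = Fin n → Fin n

allVerts : (n : ℕ) → List (Fin n)
allVerts n = allFinL n

maxL : ∀ {n} → List (Fin n) → Maybe (Fin n)
maxL [] = nothing
maxL (x ∷ xs) with maxL xs
... | nothing = just x
... | just y = if ⌊ x ≤? y ⌋ then just y else just x

filterB : ∀ {A : Set} → (A → Bool) → List A → List A
filterB p [] = []
filterB p (x ∷ xs) = if p x then x ∷ filterB p xs else filterB p xs

update : ∀ {n} → Graph n → Val n → Fin n → Val n
update {n} G f v' u = if ⌊ u ≟ v' ⌋ then newVal else f u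
  where
  newVal : Fin n
  newVal with maxL (map f (filterB (λ w → not ⌊ w ≟ v' ⌋ ∧ Graph.adj G v' w) (allVerts n)))
  ... | nothing = f v'
  ... | just m  = m

eqVal : ∀ {n} → Val n → Val n → Bool
eqVal {n} f g = all (λ v → ⌊ f v ≟ g v ⌋) (allVerts n)

allFuns : (m n : ℕ) → List (Fin m → Fin n)
allFuns zero n = (λ ()) ∷ []
allFuns (suc m) n =
  concatMap (λ a → map (λ g → cons a g) (allFuns m n)) (allVerts n)
  where
  cons : Fin n → (Fin m → Fin n) → Fin (suc m) → Fin n
  cons a g zero = a
  cons a g (suc i) = g i

allVals : (n : ℕ) → List (Val n)
allVals n = allFuns n n

-- Edges of the Markov chain of possibilities: f → g iff g = update f v for
-- some v (each vertex chosen with probability 1/n > 0).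
-- reachIn k f g : g reachable from f by a directed path of length ≤ k.
reachIn : ∀ {n} → Graph n → ℕ → Val n → Val n → Bool
reachIn G zero f g = eqVal f g
reachIn {n} G (suc k) f g =
  eqVal f g ∨ any (λ v → reachIn G k (update G f v) g) (allVerts n)

-- reachability in the chain of possibilities (n ^ n = number of valuations
-- bounds the length of a shortest path)
reach : ∀ {n} → Graph n → Val n → Val n → Bool
reach {n} G = reachIn G (n ^ n)

-- f lies in an absorbing component (a strongly connected component with no
-- edge leaving it) iff every valuation reachable from f reaches f back.
absorbing : ∀ {n} → Graph n → Val n → Bool
absorbing {n} G f = all (λ g → not (reach G f g) ∨ reach G g f) (allVals n)

invN : ℕ → ℚ
invN zero = 0ℚ
invN (suc m) = + 1 / suc m

sumℚ : List ℚ → ℚ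
sumℚ = foldr _+_ 0ℚ

-- survive G j f = P(Y_f > j) = P(f_0, …, f_j all outside absorbing components)
survive : ∀ {n} → Graph n → ℕ → Val n → ℚ
survive G zero f = if absorbing G f then 0ℚ else 1ℚ
survive {n} G (suc j) f = if absorbing G f then 0ℚ
  else invN n * sumℚ (map (λ v → survive G j (update G f v)) (allVerts n))

-- truncated expectation: Σ_{j<k} P(Y_f > j).  Since Y_f ≥ 0 is integer
-- valued, T(G,f) = E[Y_f] = sup_k expTrunc G k f (possibly +∞).
expTrunc : ∀ {n} → Graph n → ℕ → Val n → ℚ
expTrunc G zero f = 0ℚ
expTrunc G (suc k) f = expTrunc G k f + survive G k f

pathAdj : ∀ {n} → Fin n → Fin n → Bool
pathAdj i j = (suc (toℕ i) ≡ᵇ toℕ j) ∨ (suc (toℕ j) ≡ᵇ toℕ i)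

pathAdj-sym : ∀ {n} (i j : Fin n) → pathAdj i j ≡ pathAdj j i
pathAdj-sym i j = ∨-comm (suc (toℕ i) ≡ᵇ toℕ j) (suc (toℕ j) ≡ᵇ toℕ i)

private
  sucᵇ : ∀ m → (suc m ≡ᵇ m) ≡ false
  sucᵇ zero = refl
  sucᵇ (suc m) = sucᵇ m

pathAdj-irrefl : ∀ {n} (i : Fin n) → pathAdj i i ≡ false
pathAdj-irrefl i rewrite sucᵇ (toℕ i) = refl

P : (n : ℕ) → Graph n
P n = record { adj = pathAdj ; symm = pathAdj-sym ; loopless = pathAdj-irrefl }

module Submission where

-- Both bounds come from potentials for the absorption time.
--
-- Upper bound, on any connected graph: call a vertex settled if it carries the global maximum and
-- has a neighbour with the same value. A settled vertex stays settled, and if the valuation is not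
-- constant then some vertex next to a maximum is not yet maximal; choosing it (probability 1/n)
-- settles it. So n times the number of unsettled vertices, at most n², drops by at least 1 per round
-- in expectation, which bounds the expected absorption time by n².
--
-- Lower bound, on the path: from the valuation with value 1 on the first two vertices and 0
-- elsewhere, the 1s always form an initial segment [0, r], which grows only when vertex r + 1 is
-- chosen. Absorption needs n − 2 such advances of n expected rounds each; T is a supremum of
-- truncated expectations, and truncating at the horizon n(n − 2) costs a factor 2, giving n²/4.

open import Defs
open import Data.Nat using (ℕ)
open import Data.Nat as ℕ using ()
open import Data.Integer using (+_)
open import Data.Rational using (ℚ; 0ℚ; _/_; _*_; _-_; _<_; _≤_)
open import Data.Product using (Σ; ∃; _×_)

open import Data.Bool using (Bool; true; false; _∧_; _∨_; not; T)
open import Data.Bool.ListAction using (any)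
open import Data.Bool.Properties using (T-≡; ¬-not; ∨-zeroʳ)
import Data.Bool.Properties as Boolₚ
open import Data.Empty using (⊥-elim)
open import Data.Fin using (Fin; zero; suc; toℕ)
import Data.Fin as Fin
import Data.Fin.Properties as Finₚ
open import Data.Fin.Subset using (Subset; ∣_∣) renaming (_∈_ to _∈ₛ_; _⊆_ to _⊆ₛ_; _⊂_ to _⊂ₛ_)
open import Data.Fin.Subset.Properties using (p⊆q⇒∣p∣≤∣q∣; p⊂q⇒∣p∣<∣q∣; ∣p∣≤n)
import Data.Integer as ℤ
import Data.Integer.Properties as ℤₚ
open import Data.List using (List; []; _∷_; map; length; tabulate)
open import Data.List.Membership.Propositional using (_∈_; lose)
open import Data.List.Membership.Propositional.Properties using (∈-map⁺; ∈-map⁻; ∈-allFin; ∈-concat⁺′)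
open import Data.List.Properties using (length-tabulate; map-tabulate)
open import Data.List.Relation.Unary.All as All using ()
open import Data.List.Relation.Unary.All.Properties using (all⁺; all⁻)
open import Data.List.Relation.Unary.Any using (here; there; satisfied)
open import Data.List.Relation.Unary.Any.Properties using (any⁺; any⁻)
open import Data.Maybe using (just; nothing; fromMaybe)
open import Data.Nat using (zero; suc)
open import Data.Nat.ListAction using (sum)
import Data.Nat.Coprimality as Coprimality
import Data.Nat.Properties as ℕₚ
open import Data.Nat.Tactic.RingSolver using (solve-∀)
open import Data.Product using (_,_; proj₁; proj₂; ∃₂)
open import Data.Rational using (1ℚ; _+_; mkℚ; *≤*; *<*)
import Data.Rational as ℚ
import Data.Rational.Properties as ℚₚ
open import Data.Rational.Solver using (module +-*-Solver)
open import Data.Sum using (_⊎_; inj₁; inj₂)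
import Data.Vec as Vec
import Data.Vec.Properties as Vecₚ
open import Function using (_∘_; id; Equivalence)
open import Relation.Binary.PropositionalEquality
open import Relation.Nullary using (¬_; yes; no; Dec; _×-dec_; ¬?)
open import Relation.Nullary.Decidable using (⌊_⌋; toWitness; fromWitness; decidable-stable)
open import Relation.Unary using (Decidable)

-- Sums, averages and the embedding of ℕ into ℚ

private
  true≢false : true ≢ false
  true≢false ()

-- Opaque so that unification never normalises the gcd computations hidden in + a / 1.
opaque
  toℚ : ℕ → ℚ
  toℚ a = + a / 1

  toℚ-≡ : ∀ a → toℚ a ≡ + a / 1
  toℚ-≡ a = refl

  toℚ-0 : toℚ 0 ≡ 0ℚ
  toℚ-0 = refl

  toℚ-1 : toℚ 1 ≡ 1ℚ
  toℚ-1 = refl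

  private
    toℚ-mkℚ : ∀ a → toℚ a ≡ mkℚ (+ a) 0 (Coprimality.sym (Coprimality.1-coprimeTo a))
    toℚ-mkℚ a = ℚₚ.↥p/↧p≡p (mkℚ (+ a) 0 (Coprimality.sym (Coprimality.1-coprimeTo a)))

  toℚ-+ : ∀ a b → toℚ (a ℕ.+ b) ≡ toℚ a + toℚ b
  toℚ-+ a b = trans (ℚₚ./-cong {p₁ = + (a ℕ.+ b)} {q₁ = 1} numerator refl)
    (cong₂ _+_ (sym (toℚ-mkℚ a)) (sym (toℚ-mkℚ b)))
    where
    numerator : + (a ℕ.+ b) ≡ + a ℤ.* + 1 ℤ.+ + b ℤ.* + 1
    numerator rewrite ℤₚ.*-identityʳ (+ a) | ℤₚ.*-identityʳ (+ b) = refl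

  toℚ-* : ∀ a b → toℚ (a ℕ.* b) ≡ toℚ a * toℚ b
  toℚ-* a b = trans (ℚₚ./-cong {p₁ = + (a ℕ.* b)} {q₁ = 1} (ℤₚ.pos-* a b) refl)
    (cong₂ _*_ (sym (toℚ-mkℚ a)) (sym (toℚ-mkℚ b)))

  toℚ-mono-≤ : ∀ {a b} → a ℕ.≤ b → toℚ a ≤ toℚ b
  toℚ-mono-≤ {a} {b} a≤b rewrite toℚ-mkℚ a | toℚ-mkℚ b =
    *≤* (subst₂ ℤ._≤_ (sym (ℤₚ.*-identityʳ (+ a))) (sym (ℤₚ.*-identityʳ (+ b))) (ℤ.+≤+ a≤b))

  invN-*-toℚ : ∀ m → invN (suc m) * toℚ (suc m) ≡ 1ℚ
  invN-*-toℚ m = trans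
    (cong₂ _*_ (ℚₚ.↥p/↧p≡p (mkℚ (+ 1) m (Coprimality.1-coprimeTo (suc m)))) (toℚ-mkℚ (suc m)))
    (ℚₚ.*-inverseˡ (mkℚ (+ suc m) 0 (Coprimality.sym (Coprimality.1-coprimeTo (suc m)))))

+-cancelʳ-≤ : ∀ {p q r} → p + r ≤ q + r → p ≤ q
+-cancelʳ-≤ {p} {q} {r} p+r≤q+r = begin
  p             ≡⟨ cancel p r ⟨
  p + r + ℚ.- r ≤⟨ ℚₚ.+-monoˡ-≤ (ℚ.- r) p+r≤q+r ⟩
  q + r + ℚ.- r ≡⟨ cancel q r ⟩
  q             ∎
  where
  open ℚₚ.≤-Reasoning
  open +-*-Solver
  cancel : ∀ p r → p + r + ℚ.- r ≡ p
  cancel = solve 2 (λ p r → p :+ r :+ (:- r) := p) refl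

invN-*-monoʳ-≤ : ∀ m {p q} → p ≤ q → invN (suc m) * p ≤ invN (suc m) * q
invN-*-monoʳ-≤ m = ℚₚ.*-monoˡ-≤-nonNeg (invN (suc m)) {{ℚₚ.normalize-nonNeg 1 (suc m)}}

module _ {A : Set} where

  sumℚ-+ : (x y : A → ℚ) (xs : List A) →
    sumℚ (map (λ v → x v + y v) xs) ≡ sumℚ (map x xs) + sumℚ (map y xs)
  sumℚ-+ x y [] = refl
  sumℚ-+ x y (v ∷ xs) rewrite sumℚ-+ x y xs =
    solve 4 (λ a b c d → (a :+ b) :+ (c :+ d) := (a :+ c) :+ (b :+ d)) refl
      (x v) (y v) (sumℚ (map x xs)) (sumℚ (map y xs))
    where open +-*-Solver

  sumℚ-0 : (xs : List A) → sumℚ (map (λ _ → 0ℚ) xs) ≡ 0ℚ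
  sumℚ-0 []       = refl
  sumℚ-0 (_ ∷ xs) rewrite sumℚ-0 xs = refl

  sumℚ-toℚ : (φ : A → ℕ) (xs : List A) → sumℚ (map (toℚ ∘ φ) xs) ≡ toℚ (sum (map φ xs))
  sumℚ-toℚ φ [] = sym toℚ-0
  sumℚ-toℚ φ (v ∷ xs) rewrite sumℚ-toℚ φ xs = sym (toℚ-+ (φ v) (sum (map φ xs)))

  sumℚ-mono-≤ : {x y : A → ℚ} (xs : List A) → (∀ v → x v ≤ y v) →
    sumℚ (map x xs) ≤ sumℚ (map y xs)
  sumℚ-mono-≤ [] x≤y = ℚₚ.≤-refl
  sumℚ-mono-≤ (v ∷ xs) x≤y = ℚₚ.+-mono-≤ (x≤y v) (sumℚ-mono-≤ xs x≤y)

toℚ-+-invN : ∀ m c s → toℚ c + invN (suc m) * toℚ s ≡ invN (suc m) * toℚ (suc m ℕ.* c ℕ.+ s)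
toℚ-+-invN m c s = sym (begin
  i * toℚ (suc m ℕ.* c ℕ.+ s)
    ≡⟨ cong (i *_) (trans (toℚ-+ (suc m ℕ.* c) s) (cong (_+ toℚ s) (toℚ-* (suc m) c))) ⟩
  i * (toℚ (suc m) * toℚ c + toℚ s)
    ≡⟨ solve 4 (λ i N c s → i :* (N :* c :+ s) := (i :* N) :* c :+ i :* s) refl i (toℚ (suc m)) (toℚ c) (toℚ s) ⟩
  (i * toℚ (suc m)) * toℚ c + i * toℚ s ≡⟨ cong (λ t → t * toℚ c + i * toℚ s) (invN-*-toℚ m) ⟩
  1ℚ * toℚ c + i * toℚ s               ≡⟨ cong (_+ i * toℚ s) (ℚₚ.*-identityˡ (toℚ c)) ⟩
  toℚ c + i * toℚ s                    ∎)
  where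
  open ≡-Reasoning
  open +-*-Solver
  i = invN (suc m)

toℚ-invN : ∀ m a → toℚ a ≡ invN (suc m) * toℚ (suc m ℕ.* a)
toℚ-invN m a = sym (begin
  i * toℚ (suc m ℕ.* a)      ≡⟨ cong (i *_) (toℚ-* (suc m) a) ⟩
  i * (toℚ (suc m) * toℚ a)  ≡⟨ ℚₚ.*-assoc i (toℚ (suc m)) (toℚ a) ⟨
  (i * toℚ (suc m)) * toℚ a  ≡⟨ cong (_* toℚ a) (invN-*-toℚ m) ⟩
  1ℚ * toℚ a                 ≡⟨ ℚₚ.*-identityˡ (toℚ a) ⟩
  toℚ a                      ∎)
  where
  open ≡-Reasoning
  i = invN (suc m)

module _ {A : Set} (m : ℕ) (xs : List A) {x : A → ℚ} (φ : A → ℕ) (c a : ℕ) where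

  private
    i = invN (suc m)

  average-≤ : (∀ v → x v ≤ toℚ (φ v)) → suc m ℕ.* c ℕ.+ sum (map φ xs) ℕ.≤ suc m ℕ.* a →
    toℚ c + i * sumℚ (map x xs) ≤ toℚ a
  average-≤ x≤φ drift = begin
    toℚ c + i * sumℚ (map x xs)          ≤⟨ ℚₚ.+-monoʳ-≤ (toℚ c) (invN-*-monoʳ-≤ m (sumℚ-mono-≤ xs x≤φ)) ⟩
    toℚ c + i * sumℚ (map (toℚ ∘ φ) xs)  ≡⟨ cong (λ t → toℚ c + i * t) (sumℚ-toℚ φ xs) ⟩
    toℚ c + i * toℚ (sum (map φ xs))     ≡⟨ toℚ-+-invN m c (sum (map φ xs)) ⟩
    i * toℚ (suc m ℕ.* c ℕ.+ sum (map φ xs)) ≤⟨ invN-*-monoʳ-≤ m (toℚ-mono-≤ drift) ⟩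
    i * toℚ (suc m ℕ.* a)                ≡⟨ toℚ-invN m a ⟨
    toℚ a                                ∎
    where open ℚₚ.≤-Reasoning

  average-≥ : (∀ v → toℚ (φ v) ≤ x v) → suc m ℕ.* a ℕ.≤ suc m ℕ.* c ℕ.+ sum (map φ xs) →
    toℚ a ≤ toℚ c + i * sumℚ (map x xs)
  average-≥ φ≤x drift = begin
    toℚ a                                ≡⟨ toℚ-invN m a ⟩
    i * toℚ (suc m ℕ.* a)                ≤⟨ invN-*-monoʳ-≤ m (toℚ-mono-≤ drift) ⟩
    i * toℚ (suc m ℕ.* c ℕ.+ sum (map φ xs)) ≡⟨ toℚ-+-invN m c (sum (map φ xs)) ⟨
    toℚ c + i * toℚ (sum (map φ xs))     ≡⟨ cong (λ t → toℚ c + i * t) (sumℚ-toℚ φ xs) ⟨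
    toℚ c + i * sumℚ (map (toℚ ∘ φ) xs)  ≤⟨ ℚₚ.+-monoʳ-≤ (toℚ c) (invN-*-monoʳ-≤ m (sumℚ-mono-≤ xs φ≤x)) ⟩
    toℚ c + i * sumℚ (map x xs)          ∎
    where open ℚₚ.≤-Reasoning

module _ {A : Set} where

  sum-map-+ : (g : A → ℕ) (k : ℕ) (xs : List A) →
    sum (map (λ v → g v ℕ.+ k) xs) ≡ sum (map g xs) ℕ.+ length xs ℕ.* k
  sum-map-+ g k []       = refl
  sum-map-+ g k (v ∷ xs) rewrite sum-map-+ g k xs = solve-∀′ (g v) k (sum (map g xs)) (length xs ℕ.* k)
    where
    solve-∀′ : ∀ a k s t → a ℕ.+ k ℕ.+ (s ℕ.+ t) ≡ a ℕ.+ s ℕ.+ (k ℕ.+ t)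
    solve-∀′ = solve-∀

  sum-map-const : (k : ℕ) (xs : List A) → sum (map (λ _ → k) xs) ≡ length xs ℕ.* k
  sum-map-const k []       = refl
  sum-map-const k (_ ∷ xs) = cong (k ℕ.+_) (sum-map-const k xs)

sum-tabulate-≤ : ∀ N (g : Fin N → ℕ) {a} → (∀ v → g v ℕ.≤ a) → sum (tabulate g) ℕ.≤ N ℕ.* a
sum-tabulate-≤ zero    g g≤a = ℕ.z≤n
sum-tabulate-≤ (suc N) g g≤a = ℕₚ.+-mono-≤ (g≤a zero) (sum-tabulate-≤ N (g ∘ suc) (g≤a ∘ suc))

sum-tabulate-≥ : ∀ N (g : Fin N → ℕ) {a} → (∀ v → a ℕ.≤ g v) → N ℕ.* a ℕ.≤ sum (tabulate g)
sum-tabulate-≥ zero    g a≤g = ℕ.z≤n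
sum-tabulate-≥ (suc N) g a≤g = ℕₚ.+-mono-≤ (a≤g zero) (sum-tabulate-≥ N (g ∘ suc) (a≤g ∘ suc))

private
  *-+-suc-≤ : ∀ n p k {s} → n ℕ.* p ℕ.≤ n ℕ.+ s →
    n ℕ.* (p ℕ.+ suc k) ℕ.≤ n ℕ.* 2 ℕ.+ (s ℕ.+ n ℕ.* k)
  *-+-suc-≤ n p k {s} np≤n+s = begin
    n ℕ.* (p ℕ.+ suc k)          ≡⟨ expand n p k ⟩
    n ℕ.* p ℕ.+ (n ℕ.+ n ℕ.* k)  ≤⟨ ℕₚ.+-monoˡ-≤ (n ℕ.+ n ℕ.* k) np≤n+s ⟩
    n ℕ.+ s ℕ.+ (n ℕ.+ n ℕ.* k)  ≡⟨ regroup n s (n ℕ.* k) ⟩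
    n ℕ.* 2 ℕ.+ (s ℕ.+ n ℕ.* k)  ∎
    where
    open ℕₚ.≤-Reasoning
    expand : ∀ n p k → n ℕ.* (p ℕ.+ suc k) ≡ n ℕ.* p ℕ.+ (n ℕ.+ n ℕ.* k)
    expand = solve-∀
    regroup : ∀ n s t → n ℕ.+ s ℕ.+ (n ℕ.+ t) ≡ n ℕ.* 2 ℕ.+ (s ℕ.+ t)
    regroup = solve-∀

  +-swapʳ : ∀ x y z → x ℕ.+ y ℕ.+ z ≡ x ℕ.+ z ℕ.+ y
  +-swapʳ = solve-∀

sum-tabulate-≤-except : ∀ N (g : Fin N → ℕ) w {a d} → (∀ v → v ≢ w → g v ℕ.≤ a) → g w ℕ.+ d ℕ.≤ a →
  sum (tabulate g) ℕ.+ d ℕ.≤ N ℕ.* a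
sum-tabulate-≤-except (suc N) g zero {a} g≤a gw+d≤a = subst (ℕ._≤ suc N ℕ.* a) (+-swapʳ (g zero) _ _)
  (ℕₚ.+-mono-≤ gw+d≤a (sum-tabulate-≤ N (g ∘ suc) (λ v → g≤a (suc v) λ ())))
sum-tabulate-≤-except (suc N) g (suc w) {a} g≤a gw+d≤a = subst (ℕ._≤ suc N ℕ.* a) (sym (ℕₚ.+-assoc (g zero) _ _))
  (ℕₚ.+-mono-≤ (g≤a zero λ ())
    (sum-tabulate-≤-except N (g ∘ suc) w (λ v v≢w → g≤a (suc v) (v≢w ∘ Finₚ.suc-injective)) gw+d≤a))

sum-tabulate-≥-except : ∀ N (g : Fin N → ℕ) w {a d} → (∀ v → v ≢ w → a ℕ.≤ g v) → a ℕ.≤ g w ℕ.+ d →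
  N ℕ.* a ℕ.≤ sum (tabulate g) ℕ.+ d
sum-tabulate-≥-except (suc N) g zero {a} a≤g a≤gw+d = subst (suc N ℕ.* a ℕ.≤_) (+-swapʳ (g zero) _ _)
  (ℕₚ.+-mono-≤ a≤gw+d (sum-tabulate-≥ N (g ∘ suc) (λ v → a≤g (suc v) λ ())))
sum-tabulate-≥-except (suc N) g (suc w) {a} a≤g a≤gw+d = subst (suc N ℕ.* a ℕ.≤_) (sym (ℕₚ.+-assoc (g zero) _ _))
  (ℕₚ.+-mono-≤ (a≤g zero λ ())
    (sum-tabulate-≥-except N (g ∘ suc) w (λ v v≢w → a≤g (suc v) (v≢w ∘ Finₚ.suc-injective)) a≤gw+d))

-- One round of the maximum dynamics

module _ {A : Set} (p : A → Bool) where

  ∈-filterB⁺ : ∀ {xs y} → y ∈ xs → p y ≡ true → y ∈ filterB p xs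
  ∈-filterB⁺ {x ∷ xs} (here refl) py rewrite py = here refl
  ∈-filterB⁺ {x ∷ xs} (there y∈xs) py with p x
  ... | true  = there (∈-filterB⁺ y∈xs py)
  ... | false = ∈-filterB⁺ y∈xs py

  ∈-filterB⁻ : ∀ {xs y} → y ∈ filterB p xs → p y ≡ true
  ∈-filterB⁻ {x ∷ xs} y∈ with p x in px
  ∈-filterB⁻ {x ∷ xs} (here refl)  | true = px
  ∈-filterB⁻ {x ∷ xs} (there y∈xs) | true = ∈-filterB⁻ {xs} y∈xs
  ... | false = ∈-filterB⁻ {xs} y∈

module _ {n : ℕ} where

  maxL-∈ : ∀ (xs : List (Fin n)) {m} → maxL xs ≡ just m → m ∈ xs
  maxL-∈ (x ∷ xs) eq with maxL xs in eq′
  maxL-∈ (x ∷ xs) refl | nothing = here refl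
  ... | just y with x Finₚ.≤? y
  maxL-∈ (x ∷ xs) refl | just y | yes _ = there (maxL-∈ xs eq′)
  maxL-∈ (x ∷ xs) refl | just y | no _  = here refl

  maxL-upper : ∀ (xs : List (Fin n)) {y} → y ∈ xs → ∃ λ m → maxL xs ≡ just m × y Fin.≤ m
  maxL-upper (x ∷ xs) y∈ with maxL xs in eq
  maxL-upper (x ∷ xs) (here refl)  | nothing = x , refl , Finₚ.≤-refl
  maxL-upper (x ∷ xs) (there y∈xs) | nothing with maxL-upper xs y∈xs
  ... | _ , eq′ , _ with trans (sym eq) eq′
  ... | ()
  maxL-upper (x ∷ xs) y∈ | just z with x Finₚ.≤? z
  maxL-upper (x ∷ xs) (here refl)  | just z | yes x≤z = z , refl , x≤z
  maxL-upper (x ∷ xs) (here refl)  | just z | no _    = x , refl , Finₚ.≤-refl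
  maxL-upper (x ∷ xs) (there y∈xs) | just z | x≤?z with maxL-upper xs y∈xs
  ... | _ , eq′ , y≤z with trans (sym eq) eq′
  maxL-upper (x ∷ xs) (there y∈xs) | just z | yes _  | _ , _ , y≤z | refl = z , refl , y≤z
  maxL-upper (x ∷ xs) (there y∈xs) | just z | no x≰z | _ , _ , y≤z | refl =
    x , refl , Finₚ.≤-trans y≤z (ℕₚ.≰⇒≥ x≰z)

module _ {n : ℕ} (G : Graph n) where

  open Graph G

  neighbourValues : Val n → Fin n → List (Fin n)
  neighbourValues f v = map f (filterB (λ w → not ⌊ w Finₚ.≟ v ⌋ ∧ adj v w) (allVerts n))

  adj⇒≢ : ∀ {v y} → adj v y ≡ true → y ≢ v
  adj⇒≢ {v} vy refl = true≢false (trans (sym vy) (loopless v))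

  ∈-neighbourValues⁺ : ∀ f {v y} → adj v y ≡ true → f y ∈ neighbourValues f v
  ∈-neighbourValues⁺ f {v} {y} vy = ∈-map⁺ f (∈-filterB⁺ _ (∈-allFin y) selected)
    where
    selected : not ⌊ y Finₚ.≟ v ⌋ ∧ adj v y ≡ true
    selected with y Finₚ.≟ v
    ... | yes y≡v = ⊥-elim (adj⇒≢ vy y≡v)
    ... | no _    = vy

  ∈-neighbourValues⁻ : ∀ f {v m} → m ∈ neighbourValues f v → ∃ λ y → adj v y ≡ true × m ≡ f y
  ∈-neighbourValues⁻ f {v} m∈ with ∈-map⁻ f m∈
  ... | y , y∈ , m≡fy = y , adjacent (∈-filterB⁻ _ {allVerts n} y∈) , m≡fy
    where
    adjacent : ∀ {b c} → b ∧ c ≡ true → c ≡ true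
    adjacent {true} bc = bc

  update-other : ∀ f v {u} → u ≢ v → update G f v u ≡ f u
  update-other f v {u} u≢v with u Finₚ.≟ v
  ... | yes u≡v = ⊥-elim (u≢v u≡v)
  ... | no _    = refl

  update-self : ∀ f v → update G f v v ≡ fromMaybe (f v) (maxL (neighbourValues f v))
  update-self f v with v Finₚ.≟ v
  ... | no v≢v = ⊥-elim (v≢v refl)
  ... | yes _ with maxL (neighbourValues f v)
  ...   | nothing = refl
  ...   | just _  = refl

  update-self-cases : ∀ f v →
    update G f v v ≡ f v ⊎ ∃ λ y → adj v y ≡ true × update G f v v ≡ f y
  update-self-cases f v rewrite update-self f v with maxL (neighbourValues f v) in eq
  ... | nothing = inj₁ refl
  ... | just m with ∈-neighbourValues⁻ f (maxL-∈ (neighbourValues f v) eq)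
  ...   | y , vy , m≡fy = inj₂ (y , vy , m≡fy)

  update-self-≥ : ∀ f {v y} → adj v y ≡ true → f y Fin.≤ update G f v v
  update-self-≥ f {v} vy rewrite update-self f v
    with maxL-upper (neighbourValues f v) (∈-neighbourValues⁺ f vy)
  ... | m , eq , fy≤m rewrite eq = fy≤m

  update-value : ∀ f v u → ∃ λ w → update G f v u ≡ f w
  update-value f v u = byCases (u Finₚ.≟ v)
    where
    byCases : Dec (u ≡ v) → ∃ λ w → update G f v u ≡ f w
    byCases (no u≢v) = u , update-other f v u≢v
    byCases (yes refl) with update-self-cases f u
    ... | inj₁ eq           = u , eq
    ... | inj₂ (y , _ , eq) = y , eq

-- The chain of possibilities

module _ {n : ℕ} where

  eqVal⇒≗ : ∀ {f g : Val n} → eqVal f g ≡ true → f ≗ g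
  eqVal⇒≗ {f} {g} eq v =
    toWitness (All.lookup (all⁺ (λ v → ⌊ f v Finₚ.≟ g v ⌋) (allVerts n) (Equivalence.from T-≡ eq)) (∈-allFin v))

  ≗⇒eqVal : ∀ {f g : Val n} → f ≗ g → eqVal f g ≡ true
  ≗⇒eqVal {f} {g} f≗g = Equivalence.to T-≡
    (all⁻ (λ v → ⌊ f v Finₚ.≟ g v ⌋) {allVerts n} (All.tabulate λ {v} _ → fromWitness (f≗g v)))

allFuns-complete : ∀ m n (g : Fin m → Fin n) → ∃ λ g′ → g′ ∈ allFuns m n × g′ ≗ g
allFuns-complete zero    n g = _ , here refl , λ ()
allFuns-complete (suc m) n g with allFuns-complete m n (g ∘ suc)
... | g′ , g′∈ , g′≗g = _ , ∈-concat⁺′ (∈-map⁺ _ g′∈) (∈-map⁺ _ (∈-allFin (g zero))) , agrees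
  where
  agrees : ∀ i → _ ≡ g i
  agrees zero    = refl
  agrees (suc i) = g′≗g i

module _ {n : ℕ} (G : Graph n) where

  reachIn-≗ : ∀ k {f g : Val n} → f ≗ g → reachIn G k f g ≡ true
  reachIn-≗ zero    f≗g = ≗⇒eqVal f≗g
  reachIn-≗ (suc k) f≗g rewrite ≗⇒eqVal f≗g = refl

  reachIn-update : ∀ k {f g} v → update G f v ≗ g → reachIn G (suc k) f g ≡ true
  reachIn-update k {f} {g} v fv≗g = trans (cong (eqVal f g ∨_) next) (∨-zeroʳ (eqVal f g))
    where
    next : any (λ w → reachIn G k (update G f w) g) (allVerts n) ≡ true
    next = Equivalence.to T-≡ (any⁺ _ (lose (∈-allFin v) (Equivalence.from T-≡ (reachIn-≗ k fv≗g))))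

  reach-update : ∀ {f g} v → update G f v ≗ g → reach G f g ≡ true
  reach-update {f} {g} v fv≗g = subst (λ k → reachIn G k f g ≡ true) (ℕₚ.suc-pred (n ℕ.^ n))
    (reachIn-update (ℕ.pred (n ℕ.^ n)) v fv≗g)
    where instance
      _ = Finₚ.nonZeroIndex v
      _ = ℕₚ.m^n≢0 n n

  module _ (I : Val n → Set) (respects : ∀ {f g} → f ≗ g → I f → I g)
           (closed : ∀ f v → I f → I (update G f v)) where

    reachIn-preserves : ∀ k {f g} → I f → reachIn G k f g ≡ true → I g
    reachIn-preserves zero    If f↝g = respects (eqVal⇒≗ f↝g) If
    reachIn-preserves (suc k) {f} {g} If f↝g with eqVal f g in f≡g
    ... | true  = respects (eqVal⇒≗ f≡g) If
    ... | false with satisfied (any⁻ _ (allVerts n) (Equivalence.from T-≡ f↝g))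
    ...   | v , fv↝g = reachIn-preserves k (closed f v If) (Equivalence.to T-≡ fv↝g)

    absorbing-if-trapped : ∀ {f} → I f → (∀ {g} → I g → g ≗ f) → absorbing G f ≡ true
    absorbing-if-trapped {f} If trapped = Equivalence.to T-≡
      (all⁻ (λ g → not (reach G f g) ∨ reach G g f) {allVals n} (All.tabulate λ {g} _ → returns g))
      where
      returns : ∀ g → T (not (reach G f g) ∨ reach G g f)
      returns g with reach G f g in f↝g
      ... | false = _
      ... | true  = Equivalence.from T-≡
        (reachIn-≗ (n ℕ.^ n) (trapped (reachIn-preserves (n ℕ.^ n) If f↝g)))

    absorbing-if-escapes : ∀ {f} v → I (update G f v) → ¬ I f → absorbing G f ≡ false
    absorbing-if-escapes {f} v Ifv ¬If = ¬-not stuck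
      where
      stuck : absorbing G f ≢ true
      stuck f-abs with allFuns-complete n n (update G f v)
      ... | g , g∈ , g≗fv = ¬If (reachIn-preserves (n ℕ.^ n) (respects (sym ∘ g≗fv) Ifv)
        (modusPonens (reach-update v (sym ∘ g≗fv))
          (All.lookup (all⁺ _ (allVals n) (Equivalence.from T-≡ f-abs)) g∈)))
        where
        modusPonens : ∀ {a b} → a ≡ true → T (not a ∨ b) → b ≡ true
        modusPonens refl = Equivalence.to T-≡

  constant-absorbing : ∀ (c : Fin n) {f} → (∀ u → f u ≡ c) → absorbing G f ≡ true
  constant-absorbing c f≡c = absorbing-if-trapped (λ g → ∀ u → g u ≡ c)
    (λ f≗g f≡c u → trans (sym (f≗g u)) (f≡c u)) closed f≡c (λ g≡c u → trans (g≡c u) (sym (f≡c u)))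
    where
    closed : ∀ f v → (∀ u → f u ≡ c) → ∀ u → update G f v u ≡ c
    closed f v f≡c u with update-value G f v u
    ... | w , eq = trans eq (f≡c w)

  survive-absorbing : ∀ {f} → absorbing G f ≡ true → ∀ j → survive G j f ≡ 0ℚ
  survive-absorbing f-abs zero    rewrite f-abs = refl
  survive-absorbing f-abs (suc j) rewrite f-abs = refl

  expTrunc-absorbing : ∀ {f} → absorbing G f ≡ true → ∀ k → expTrunc G k f ≡ 0ℚ
  expTrunc-absorbing f-abs zero = refl
  expTrunc-absorbing f-abs (suc k)
    rewrite expTrunc-absorbing f-abs k | survive-absorbing f-abs k = refl

  expTrunc-step : ∀ {f} → absorbing G f ≡ false → ∀ k →
    expTrunc G (suc k) f ≡ 1ℚ + invN n * sumℚ (map (λ v → expTrunc G k (update G f v)) (allVerts n))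
  expTrunc-step {f} f-live zero rewrite f-live | sumℚ-0 (allVerts n) | ℚₚ.*-zeroʳ (invN n) = refl
  expTrunc-step {f} f-live (suc k) = begin
    expTrunc G (suc k) f + survive G (suc k) f  ≡⟨ cong₂ _+_ (expTrunc-step f-live k) survive-step ⟩
    (1ℚ + i * a) + i * b
      ≡⟨ solve 3 (λ i a b → (con 1ℚ :+ i :* a) :+ i :* b := con 1ℚ :+ i :* (a :+ b)) refl i a b ⟩
    1ℚ + i * (a + b)
      ≡⟨ cong (λ t → 1ℚ + i * t) (sumℚ-+ (λ v → expTrunc G k (update G f v))
                                         (λ v → survive G k (update G f v)) (allVerts n)) ⟨
    1ℚ + i * sumℚ (map (λ v → expTrunc G (suc k) (update G f v)) (allVerts n)) ∎
    where
    open ≡-Reasoning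
    open +-*-Solver
    i = invN n
    a = sumℚ (map (λ v → expTrunc G k (update G f v)) (allVerts n))
    b = sumℚ (map (λ v → survive G k (update G f v)) (allVerts n))
    survive-step : survive G (suc k) f ≡ i * b
    survive-step rewrite f-live = refl

-- Potential bounds on the truncated expectation

module _ {m : ℕ} (G : Graph (suc m)) where

  private
    N = suc m

  expTrunc-≤-potential : (h : Val N → ℕ) →
    (∀ f → absorbing G f ≡ false → N ℕ.+ sum (map (h ∘ update G f) (allVerts N)) ℕ.≤ N ℕ.* h f) →
    ∀ k f → expTrunc G k f ≤ toℚ (h f)
  expTrunc-≤-potential h drift zero    f = subst (_≤ toℚ (h f)) toℚ-0 (toℚ-mono-≤ ℕ.z≤n)
  expTrunc-≤-potential h drift (suc k) f = byAbsorption (absorbing G f) refl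
    where
    byAbsorption : ∀ b → absorbing G f ≡ b → expTrunc G (suc k) f ≤ toℚ (h f)
    byAbsorption true  f-abs = subst (_≤ toℚ (h f)) (trans toℚ-0 (sym (expTrunc-absorbing G f-abs (suc k))))
      (toℚ-mono-≤ ℕ.z≤n)
    byAbsorption false f-live = begin
      expTrunc G (suc k) f    ≡⟨ expTrunc-step G f-live k ⟩
      1ℚ + invN N * next      ≡⟨ cong (_+ invN N * next) toℚ-1 ⟨
      toℚ 1 + invN N * next   ≤⟨ average-≤ m (allVerts N) (h ∘ update G f) 1 (h f)
                                   (λ v → expTrunc-≤-potential h drift k (update G f v))
                                   (subst (λ t → t ℕ.+ sum (map (h ∘ update G f) (allVerts N)) ℕ.≤ N ℕ.* h f)
                                     (sym (ℕₚ.*-identityʳ N)) (drift f f-live)) ⟩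
      toℚ (h f)               ∎
      where
      open ℚₚ.≤-Reasoning
      next = sumℚ (map (λ v → expTrunc G k (update G f v)) (allVerts N))

  private
    doubling : ∀ (y : Fin N → ℚ) D → let i = invN N ; S = sumℚ (map y (allVerts N)) in
      (1ℚ + i * S) + (1ℚ + i * S) + toℚ D ≡ toℚ 2 + i * sumℚ (map (λ v → (y v + y v) + toℚ D) (allVerts N))
    doubling y D = sym (begin
      toℚ 2 + i * sumℚ (map (λ v → (y v + y v) + toℚ D) (allVerts N))
        ≡⟨ cong (λ t → toℚ 2 + i * t) (trans (sumℚ-+ (λ v → y v + y v) (λ _ → toℚ D) (allVerts N))
             (cong₂ _+_ (sumℚ-+ y y (allVerts N)) (sumℚ-toℚ (λ _ → D) (allVerts N)))) ⟩
      toℚ 2 + i * ((S + S) + toℚ (sum (map (λ _ → D) (allVerts N))))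
        ≡⟨ cong (λ t → toℚ 2 + i * ((S + S) + toℚ t)) sum-const ⟩
      toℚ 2 + i * ((S + S) + toℚ (N ℕ.* D))
        ≡⟨ cong₂ (λ s t → s + i * ((S + S) + t)) (trans (toℚ-+ 1 1) (cong₂ _+_ toℚ-1 toℚ-1)) (toℚ-* N D) ⟩
      (1ℚ + 1ℚ) + i * ((S + S) + toℚ N * toℚ D)
        ≡⟨ solve 4 (λ i S n d → (con 1ℚ :+ con 1ℚ) :+ i :* ((S :+ S) :+ n :* d)
                             := ((con 1ℚ :+ i :* S) :+ (con 1ℚ :+ i :* S)) :+ (i :* n) :* d) refl i S (toℚ N) (toℚ D) ⟩
      (1ℚ + i * S) + (1ℚ + i * S) + (i * toℚ N) * toℚ D
        ≡⟨ cong (λ t → (1ℚ + i * S) + (1ℚ + i * S) + t * toℚ D) (invN-*-toℚ m) ⟩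
      (1ℚ + i * S) + (1ℚ + i * S) + 1ℚ * toℚ D
        ≡⟨ cong (λ t → (1ℚ + i * S) + (1ℚ + i * S) + t) (ℚₚ.*-identityˡ (toℚ D)) ⟩
      (1ℚ + i * S) + (1ℚ + i * S) + toℚ D ∎)
      where
      open ≡-Reasoning
      open +-*-Solver
      i = invN N
      S = sumℚ (map y (allVerts N))
      sum-const : sum (map (λ _ → D) (allVerts N)) ≡ N ℕ.* D
      sum-const = trans (sum-map-const D (allVerts N)) (cong (ℕ._* D) (length-tabulate {n = N} id))

  module _ {R : Set} (State : R → Val N → Set) (pot : R → ℕ) (D : ℕ)
    (pot≤D : ∀ {r f} → State r f → pot r ℕ.≤ D)
    (absorbed : ∀ {r f} → State r f → absorbing G f ≡ true → pot r ≡ 0)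
    (drift : ∀ {r f} → State r f → absorbing G f ≡ false →
       Σ (Fin N → R) λ next → (∀ v → State (next v) (update G f v)) ×
         N ℕ.* pot r ℕ.≤ N ℕ.+ sum (map (pot ∘ next) (allVerts N)))
    where

    -- The slack D pays for the horizon: at k = 0 the bound is pot ≤ D, and one more round adds 1 to k
    -- and loses at most 1 of expected potential, while 2·E grows by 2.
    expTrunc-≥-potential : ∀ k {r f} → k ℕ.≤ D → State r f →
      toℚ (pot r ℕ.+ k) ≤ (expTrunc G k f + expTrunc G k f) + toℚ D
    expTrunc-≥-potential zero {r} _ s = subst (toℚ (pot r ℕ.+ 0) ≤_) (sym (ℚₚ.+-identityˡ (toℚ D)))
      (toℚ-mono-≤ (subst (ℕ._≤ D) (sym (ℕₚ.+-identityʳ (pot r))) (pot≤D s)))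
    expTrunc-≥-potential (suc k) {r} {f} k<D s = byAbsorption (absorbing G f) refl
      where
      E : ℕ → Val N → ℚ
      E = expTrunc G
      byAbsorption : ∀ b → absorbing G f ≡ b → toℚ (pot r ℕ.+ suc k) ≤ (E (suc k) f + E (suc k) f) + toℚ D
      byAbsorption true f-abs rewrite expTrunc-absorbing G f-abs (suc k) | absorbed s f-abs =
        subst (toℚ (suc k) ≤_) (sym (ℚₚ.+-identityˡ (toℚ D))) (toℚ-mono-≤ k<D)
      byAbsorption false f-live with drift s f-live
      ... | next , s′ , pot-drift = begin
        toℚ (pot r ℕ.+ suc k)
          ≤⟨ average-≥ m (allVerts N) (λ v → pot (next v) ℕ.+ k) 2 (pot r ℕ.+ suc k)
               (λ v → expTrunc-≥-potential k (ℕₚ.<⇒≤ k<D) (s′ v)) arith ⟩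
        toℚ 2 + invN N * sumℚ (map (λ v → (E k (update G f v) + E k (update G f v)) + toℚ D) (allVerts N))
          ≡⟨ doubling (λ v → E k (update G f v)) D ⟨
        (1ℚ + invN N * S) + (1ℚ + invN N * S) + toℚ D
          ≡⟨ cong (λ t → t + t + toℚ D) (expTrunc-step G f-live k) ⟨
        (E (suc k) f + E (suc k) f) + toℚ D ∎
        where
        open ℚₚ.≤-Reasoning
        S = sumℚ (map (λ v → E k (update G f v)) (allVerts N))
        arith : N ℕ.* (pot r ℕ.+ suc k) ℕ.≤ N ℕ.* 2 ℕ.+ sum (map (λ v → pot (next v) ℕ.+ k) (allVerts N))
        arith = subst (λ t → N ℕ.* (pot r ℕ.+ suc k) ℕ.≤ N ℕ.* 2 ℕ.+ t)
          (sym (trans (sum-map-+ (pot ∘ next) k (allVerts N))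
                      (cong (λ l → sum (map (pot ∘ next) (allVerts N)) ℕ.+ l ℕ.* k) (length-tabulate {n = N} id))))
          (*-+-suc-≤ N (pot r) k pot-drift)

-- Connected graphs: the upper bound

argmax-Fin : ∀ {m n} (f : Fin (suc m) → Fin n) → ∃ λ a → ∀ u → f u Fin.≤ f a
argmax-Fin {m} {n} f = argmax f zero (allVerts (suc m)) ,
  λ u → All.lookup (f[xs]≤f[argmax] {f = f} zero (allVerts (suc m))) (∈-allFin u)
  where open import Data.List.Extrema (Finₚ.≤-totalOrder n) using (argmax; f[xs]≤f[argmax])

-- Connectivity in cut form: an edge leaves every decidable vertex set that is neither empty nor full.
Connected : ∀ {n} → Graph n → Set₁
Connected {n} G = ∀ {S : Fin n → Set} → Decidable S → ∀ {x y} → S x → ¬ S y →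
  ∃₂ λ a w → Graph.adj G a w ≡ true × S a × ¬ S w

module _ {n : ℕ} (G : Graph n) where

  open Graph G

  Settled : Val n → Fin n → Set
  Settled f v = (∀ u → f u Fin.≤ f v) × ∃ λ y → adj v y ≡ true × f y ≡ f v

  settled? : ∀ f → Decidable (Settled f)
  settled? f v = Finₚ.all? (λ u → f u Finₚ.≤? f v)
           ×-dec Finₚ.any? (λ y → (adj v y Boolₚ.≟ true) ×-dec (f y Finₚ.≟ f v))

  settledSet : Val n → Subset n
  settledSet f = Vec.tabulate (⌊_⌋ ∘ settled? f)

  ∈-settledSet⁺ : ∀ {f v} → Settled f v → v ∈ₛ settledSet f
  ∈-settledSet⁺ {f} {v} s = Vecₚ.lookup⇒[]= v _
    (trans (Vecₚ.lookup∘tabulate (⌊_⌋ ∘ settled? f) v) (Equivalence.to T-≡ (fromWitness s)))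

  ∈-settledSet⁻ : ∀ {f v} → v ∈ₛ settledSet f → Settled f v
  ∈-settledSet⁻ {f} {v} v∈ = toWitness {a? = settled? f v} (Equivalence.from T-≡
    (trans (sym (Vecₚ.lookup∘tabulate (⌊_⌋ ∘ settled? f) v)) (Vecₚ.[]=⇒lookup v∈)))

  update-≤-max : ∀ {f} {M : Fin n} → (∀ u → f u Fin.≤ M) → ∀ v u → update G f v u Fin.≤ M
  update-≤-max {f} {M} f≤M v u with update-value G f v u
  ... | w , eq = subst (Fin._≤ M) (sym eq) (f≤M w)

  update-max-pair : ∀ {f} {M : Fin n} → (∀ u → f u Fin.≤ M) →
    ∀ {x z} → adj x z ≡ true → f x ≡ M → f z ≡ M → ∀ w → update G f w x ≡ M
  update-max-pair {f} {M} f≤M {x} {z} xz fx≡M fz≡M w = byCases (x Finₚ.≟ w)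
    where
    byCases : Dec (x ≡ w) → update G f w x ≡ M
    byCases (no x≢w)  = trans (update-other G f w x≢w) fx≡M
    byCases (yes refl) = Finₚ.≤-antisym (update-≤-max f≤M x x)
                                        (subst (Fin._≤ update G f x x) fz≡M (update-self-≥ G f xz))

  settled-stable : ∀ {f v} → Settled f v → ∀ w → Settled (update G f w) v
  settled-stable {f} {v} (f≤fv , y , vy , fy≡fv) w =
    (λ u → subst (update G f w u Fin.≤_) (sym fv′) (update-≤-max f≤fv w u)) , y , vy , trans fy′ (sym fv′)
    where
    fv′ = update-max-pair f≤fv vy refl fy≡fv w
    fy′ = update-max-pair f≤fv (trans (symm y v) vy) fy≡fv refl w

  settled-grow : ∀ {f a w} → (∀ u → f u Fin.≤ f a) → adj w a ≡ true → f w ≢ f a →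
    ¬ Settled f w × Settled (update G f w) w
  settled-grow {f} {a} {w} f≤fa wa fw≢fa =
    (λ (f≤fw , _) → fw≢fa (Finₚ.≤-antisym (f≤fa w) (f≤fw a))) ,
    (λ u → subst (update G f w u Fin.≤_) (sym fw′) (update-≤-max f≤fa w u)) , a , wa , trans fa′ (sym fw′)
    where
    fw′ : update G f w w ≡ f a
    fw′ = Finₚ.≤-antisym (update-≤-max f≤fa w w) (update-self-≥ G f wa)
    fa′ : update G f w a ≡ f a
    fa′ = update-other G f w (adj⇒≢ G wa)

module _ {m : ℕ} (G : Graph (suc m)) (connected : Connected G) where

  private
    N = suc m

  settlingVertex : ∀ {f} → absorbing G f ≡ false → ∃ λ w → ¬ Settled G f w × Settled G (update G f w) w
  settlingVertex {f} f-live =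
    let (a , f≤fa) = argmax-Fin f
        (b , fb≢fa) = Finₚ.¬∀⟶∃¬ N _ (λ u → f u Finₚ.≟ f a) λ f≡fa →
                        true≢false (trans (sym (constant-absorbing G (f a) f≡fa)) f-live)
        (a′ , w , a′w , fa′≡fa , fw≢fa) = connected (λ u → f u Finₚ.≟ f a) {a} {b} refl fb≢fa
    in w , settled-grow G (λ u → subst (f u Fin.≤_) (sym fa′≡fa) (f≤fa u))
                          (trans (Graph.symm G w a′) a′w) (λ fw≡fa′ → fw≢fa (trans fw≡fa′ fa′≡fa))

  unsettledPotential : Val N → ℕ
  unsettledPotential f = N ℕ.* (N ℕ.∸ ∣ settledSet G f ∣)

  unsettledPotential-mono : ∀ {f g} → settledSet G f ⊆ₛ settledSet G g →
    unsettledPotential g ℕ.≤ unsettledPotential f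
  unsettledPotential-mono f⊆g = ℕₚ.*-monoʳ-≤ N (ℕₚ.∸-monoʳ-≤ N (p⊆q⇒∣p∣≤∣q∣ f⊆g))

  unsettledPotential-drop : ∀ {f g} → settledSet G f ⊂ₛ settledSet G g →
    unsettledPotential g ℕ.+ N ℕ.≤ unsettledPotential f
  unsettledPotential-drop {f} {g} f⊂g = begin
    N ℕ.* (N ℕ.∸ ∣ Sg ∣) ℕ.+ N  ≡⟨ ℕₚ.+-comm _ N ⟩
    N ℕ.+ N ℕ.* (N ℕ.∸ ∣ Sg ∣)  ≡⟨ ℕₚ.*-suc N (N ℕ.∸ ∣ Sg ∣) ⟨
    N ℕ.* suc (N ℕ.∸ ∣ Sg ∣)    ≤⟨ ℕₚ.*-monoʳ-≤ N (ℕₚ.∸-monoʳ-< (p⊂q⇒∣p∣<∣q∣ f⊂g) (∣p∣≤n Sg)) ⟩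
    N ℕ.* (N ℕ.∸ ∣ Sf ∣)        ∎
    where
    open ℕₚ.≤-Reasoning
    Sf = settledSet G f
    Sg = settledSet G g

  unsettledPotential-drift : ∀ f → absorbing G f ≡ false →
    N ℕ.+ sum (map (unsettledPotential ∘ update G f) (allVerts N)) ℕ.≤ N ℕ.* unsettledPotential f
  unsettledPotential-drift f f-live = subst (ℕ._≤ N ℕ.* unsettledPotential f)
    (trans (cong (λ t → sum t ℕ.+ N) (sym (map-tabulate id (unsettledPotential ∘ update G f)))) (ℕₚ.+-comm _ N))
    (sum-tabulate-≤-except N (unsettledPotential ∘ update G f) w
      (λ v _ → unsettledPotential-mono (grows v))
      (unsettledPotential-drop (grows w , w , ∈-settledSet⁺ G Sw′ , ¬Sw ∘ ∈-settledSet⁻ G)))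
    where
    growing = settlingVertex f-live
    w = proj₁ growing
    ¬Sw = proj₁ (proj₂ growing)
    Sw′ = proj₂ (proj₂ growing)
    grows : ∀ v → settledSet G f ⊆ₛ settledSet G (update G f v)
    grows v = ∈-settledSet⁺ G ∘ (λ s → settled-stable G s v) ∘ ∈-settledSet⁻ G

  expTrunc-≤-square : ∀ k f → expTrunc G k f ≤ toℚ (N ℕ.* N)
  expTrunc-≤-square k f = ℚₚ.≤-trans (expTrunc-≤-potential G unsettledPotential unsettledPotential-drift k f)
    (toℚ-mono-≤ (ℕₚ.*-monoʳ-≤ N (ℕₚ.m∸n≤m N ∣ settledSet G f ∣)))

-- The path: connectivity and the lower bound

crossing : ∀ {Q : ℕ → Set} → Decidable Q → Q 0 → ∀ j → ¬ Q j → ∃ λ t → t ℕ.< j × Q t × ¬ Q (suc t)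
crossing Q? Q0 zero    ¬Q0 = ⊥-elim (¬Q0 Q0)
crossing Q? Q0 (suc j) ¬Qj+1 with Q? j
... | yes Qj = j , ℕₚ.n<1+n j , Qj , ¬Qj+1
... | no ¬Qj with crossing Q? Q0 j ¬Qj
...   | t , t<j , Qt , ¬Qt+1 = t , ℕₚ.m<n⇒m<1+n t<j , Qt , ¬Qt+1

module _ {n : ℕ} where

  pathAdj-suc : ∀ {v y : Fin n} → toℕ y ≡ suc (toℕ v) → pathAdj v y ≡ true
  pathAdj-suc {v} {y} y≡v+1
    rewrite y≡v+1 | Equivalence.to T-≡ (ℕₚ.≡⇒≡ᵇ (toℕ v) (toℕ v) refl) = refl

  pathAdj⇒ : ∀ {v y : Fin n} → pathAdj v y ≡ true → toℕ y ≡ suc (toℕ v) ⊎ toℕ v ≡ suc (toℕ y)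
  pathAdj⇒ {v} {y} vy with suc (toℕ v) ℕ.≡ᵇ toℕ y in eq
  ... | true  = inj₁ (sym (ℕₚ.≡ᵇ⇒≡ (suc (toℕ v)) (toℕ y) (Equivalence.from T-≡ eq)))
  ... | false = inj₂ (sym (ℕₚ.≡ᵇ⇒≡ (suc (toℕ y)) (toℕ v) (Equivalence.from T-≡ vy)))

  cut-path : ∀ {T : Fin (suc n) → Set} → Decidable T → T zero → ∀ z → ¬ T z →
    ∃₂ λ u u′ → toℕ u′ ≡ suc (toℕ u) × T u × ¬ T u′
  cut-path {T} T? T0 z ¬Tz with crossing (λ t → Finₚ.any? (λ v → (toℕ v ℕ.≟ t) ×-dec T? v))
                                   (zero , refl , T0) (toℕ z)
                                   (λ (v , v≡z , Tv) → ¬Tz (subst T (Finₚ.toℕ-injective v≡z) Tv))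
  ... | t , t<z , (u , u≡t , Tu) , ¬Tt+1 =
    u , u′ , trans (Finₚ.toℕ-fromℕ< t+1<n) (cong suc (sym u≡t)) , Tu ,
    λ Tu′ → ¬Tt+1 (u′ , Finₚ.toℕ-fromℕ< t+1<n , Tu′)
    where
    t+1<n = ℕₚ.≤-<-trans t<z (Finₚ.toℕ<n z)
    u′ = Fin.fromℕ< t+1<n

P-connected : ∀ n → Connected (P n)
P-connected (suc n) {S} S? {x} {y} Sx ¬Sy with S? zero
... | yes S0 with cut-path S? S0 y ¬Sy
...   | a , w , w≡a+1 , Sa , ¬Sw = a , w , pathAdj-suc w≡a+1 , Sa , ¬Sw
P-connected (suc n) {S} S? {x} {y} Sx ¬Sy | no ¬S0 with cut-path (¬? ∘ S?) ¬S0 x (λ ¬Sx → ¬Sx Sx)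
...   | w , a , a≡w+1 , ¬Sw , ¬¬Sa = a , w , trans (pathAdj-sym a w) (pathAdj-suc a≡w+1) ,
                                      decidable-stable (S? a) ¬¬Sa , ¬Sw

module _ (m : ℕ) where

  private
    N : ℕ
    N = suc (suc m)
    G : Graph N
    G = P N
    one : Fin N
    one = suc zero

  neighbour-below : ∀ (v : Fin N) {s} → 1 ℕ.≤ s → toℕ v ℕ.≤ suc s →
    ∃ λ y → pathAdj v y ≡ true × toℕ y ℕ.≤ s
  neighbour-below zero    1≤s _   = one , refl , 1≤s
  neighbour-below (suc v) _   v<s = Fin.inject₁ v ,
    trans (pathAdj-sym (suc v) (Fin.inject₁ v)) (pathAdj-suc (cong suc (sym (Finₚ.toℕ-inject₁ v)))) ,
    subst (ℕ._≤ _) (sym (Finₚ.toℕ-inject₁ v)) (ℕ.s≤s⁻¹ v<s)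

  OnesUpTo : ℕ → Val N → Set
  OnesUpTo r f = ∀ u → (toℕ u ℕ.≤ r → f u ≡ one) × (r ℕ.< toℕ u → f u ≡ zero)

  module _ {r : ℕ} {f : Val N} (1≤r : 1 ℕ.≤ r) (ones : OnesUpTo r f) where

    onesUpTo-≤-one : ∀ (u : Fin N) → f u Fin.≤ one
    onesUpTo-≤-one u with toℕ u ℕ.≤? r
    ... | yes u≤r = Finₚ.≤-reflexive (proj₁ (ones u) u≤r)
    ... | no u≰r  = subst (Fin._≤ one) (sym (proj₂ (ones u) (ℕₚ.≰⇒> u≰r))) ℕ.z≤n

    update-self-low : ∀ (v : Fin N) → toℕ v ℕ.≤ suc r → update G f v v ≡ one
    update-self-low v v≤r+1 with neighbour-below v 1≤r v≤r+1
    ... | y , vy , y≤r = Finₚ.≤-antisym (update-≤-max G onesUpTo-≤-one v v)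
                           (subst (Fin._≤ update G f v v) (proj₁ (ones y) y≤r) (update-self-≥ G f vy))

    update-self-high : ∀ (v : Fin N) → suc r ℕ.< toℕ v → update G f v v ≡ zero
    update-self-high v r+1<v with update-self-cases G f v
    ... | inj₁ eq = trans eq (proj₂ (ones v) (ℕₚ.<-trans (ℕₚ.n<1+n r) r+1<v))
    ... | inj₂ (y , vy , eq) = trans eq (proj₂ (ones y) r<y)
      where
      r<y : r ℕ.< toℕ y
      r<y with pathAdj⇒ vy
      ... | inj₁ y≡v+1 = subst (r ℕ.<_) (sym y≡v+1)
                           (ℕₚ.<-trans (ℕₚ.<-trans (ℕₚ.n<1+n r) r+1<v) (ℕₚ.n<1+n (toℕ v)))
      ... | inj₂ v≡y+1 = ℕ.s≤s⁻¹ (subst (suc r ℕ.<_) v≡y+1 r+1<v)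

    update-onesUpTo : ∀ (v : Fin N) → toℕ v ≢ suc r → OnesUpTo r (update G f v)
    update-onesUpTo v v≢r+1 u = byCases (u Finₚ.≟ v)
      where
      byCases : Dec (u ≡ v) → (toℕ u ℕ.≤ r → update G f v u ≡ one) × (r ℕ.< toℕ u → update G f v u ≡ zero)
      byCases (no u≢v) rewrite update-other G f v u≢v = ones u
      byCases (yes refl) =
        (λ u≤r → update-self-low u (ℕₚ.m≤n⇒m≤1+n u≤r)) ,
        (λ r<u → update-self-high u (ℕₚ.≤∧≢⇒< r<u (v≢r+1 ∘ sym)))

    update-onesUpTo-suc : ∀ (v : Fin N) → toℕ v ≡ suc r → OnesUpTo (suc r) (update G f v)
    update-onesUpTo-suc v v≡r+1 u = byCases (u Finₚ.≟ v)
      where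
      byCases : Dec (u ≡ v) →
        (toℕ u ℕ.≤ suc r → update G f v u ≡ one) × (suc r ℕ.< toℕ u → update G f v u ≡ zero)
      byCases (no u≢v) rewrite update-other G f v u≢v =
        (λ u≤r+1 → proj₁ (ones u)
          (ℕ.s≤s⁻¹ (ℕₚ.≤∧≢⇒< u≤r+1 (u≢v ∘ Finₚ.toℕ-injective ∘ (λ e → trans e (sym v≡r+1)))))) ,
        (λ r+1<u → proj₂ (ones u) (ℕₚ.<-trans (ℕₚ.n<1+n r) r+1<u))
      byCases (yes refl) =
        (λ _ → update-self-low u (ℕₚ.≤-reflexive v≡r+1)) ,
        (λ r+1<u → ⊥-elim (ℕₚ.<-irrefl (sym v≡r+1) r+1<u))

  onesUpTo-absorbing : ∀ {r f} → OnesUpTo r f → suc r ≡ N → absorbing G f ≡ true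
  onesUpTo-absorbing ones r+1≡N =
    constant-absorbing G one λ u → proj₁ (ones u) (ℕ.s≤s⁻¹ (subst (toℕ u ℕ.<_) (sym r+1≡N) (Finₚ.toℕ<n u)))

  onesUpTo-live : ∀ {r f} → 1 ℕ.≤ r → suc r ℕ.< N → OnesUpTo r f → absorbing G f ≡ false
  onesUpTo-live {r} {f} 1≤r r+1<N ones = absorbing-if-escapes G OnesBelow
    (λ f≗g ones′ i i≤ → subst (one Fin.≤_) (f≗g i) (ones′ i i≤)) closed v₀
    (λ i i≤ → Finₚ.≤-reflexive (sym (proj₁ (update-onesUpTo-suc 1≤r ones v₀ v₀≡r+1 i) i≤)))
    (λ ones′ → one≰zero (subst (one Fin.≤_) (proj₂ (ones v₀) (subst (r ℕ.<_) (sym v₀≡r+1) (ℕₚ.n<1+n r)))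
                          (ones′ v₀ (ℕₚ.≤-reflexive v₀≡r+1))))
    where
    OnesBelow : Val N → Set
    OnesBelow g = ∀ i → toℕ i ℕ.≤ suc r → one Fin.≤ g i
    v₀ : Fin N
    v₀ = Fin.fromℕ< r+1<N
    v₀≡r+1 : toℕ v₀ ≡ suc r
    v₀≡r+1 = Finₚ.toℕ-fromℕ< r+1<N
    one≰zero : ¬ (one Fin.≤ zero {n = suc m})
    one≰zero ()
    closed : ∀ g w → OnesBelow g → OnesBelow (update G g w)
    closed g w ones′ i i≤ = byCases (i Finₚ.≟ w)
      where
      byCases : Dec (i ≡ w) → one Fin.≤ update G g w i
      byCases (no i≢w) = subst (one Fin.≤_) (sym (update-other G g w i≢w)) (ones′ i i≤)
      byCases (yes refl) with neighbour-below i (ℕ.s≤s ℕ.z≤n) (ℕₚ.m≤n⇒m≤1+n i≤)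
      ... | y , iy , y≤ = Finₚ.≤-trans (ones′ y y≤) (update-self-≥ G g iy)

  FrontState : ℕ → Val N → Set
  FrontState r f = 1 ℕ.≤ r × r ℕ.< N × OnesUpTo r f

  frontPotential : ℕ → ℕ
  frontPotential r = N ℕ.* (N ℕ.∸ suc r)

  frontPotential-suc : ∀ {r} → suc r ℕ.< N → frontPotential r ≡ frontPotential (suc r) ℕ.+ N
  frontPotential-suc {r} r+1<N = begin
    N ℕ.* (N ℕ.∸ suc r)                  ≡⟨ cong (N ℕ.*_) N∸[r+1]≡1+N∸[r+2] ⟩
    N ℕ.* suc (N ℕ.∸ suc (suc r))        ≡⟨ ℕₚ.*-suc N _ ⟩
    N ℕ.+ N ℕ.* (N ℕ.∸ suc (suc r))      ≡⟨ ℕₚ.+-comm N _ ⟩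
    N ℕ.* (N ℕ.∸ suc (suc r)) ℕ.+ N      ∎
    where
    open ≡-Reasoning
    N∸[r+1]≡1+N∸[r+2] : N ℕ.∸ suc r ≡ suc (N ℕ.∸ suc (suc r))
    N∸[r+1]≡1+N∸[r+2] = trans (sym (ℕₚ.suc-pred (N ℕ.∸ suc r) {{ℕ.≢-nonZero (ℕₚ.m>n⇒m∸n≢0 r+1<N)}}))
                              (cong suc (ℕₚ.pred[m∸n]≡m∸[1+n] N (suc r)))

  advance : ℕ → Fin N → ℕ
  advance r v with toℕ v ℕ.≟ suc r
  ... | yes _ = suc r
  ... | no _  = r

  frontState-update : ∀ {r f} → FrontState r f → suc r ℕ.< N → ∀ v → FrontState (advance r v) (update G f v)
  frontState-update {r} (1≤r , r<N , ones) r+1<N v with toℕ v ℕ.≟ suc r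
  ... | yes v≡r+1 = ℕₚ.m≤n⇒m≤1+n 1≤r , r+1<N , update-onesUpTo-suc 1≤r ones v v≡r+1
  ... | no v≢r+1  = 1≤r , r<N , update-onesUpTo 1≤r ones v v≢r+1

  frontPotential-drift : ∀ {r} → suc r ℕ.< N →
    N ℕ.* frontPotential r ℕ.≤ N ℕ.+ sum (map (frontPotential ∘ advance r) (allVerts N))
  frontPotential-drift {r} r+1<N = subst (N ℕ.* frontPotential r ℕ.≤_)
    (trans (cong (λ t → sum t ℕ.+ N) (sym (map-tabulate id (frontPotential ∘ advance r)))) (ℕₚ.+-comm _ N))
    (sum-tabulate-≥-except N (frontPotential ∘ advance r) v₀ stay (ℕₚ.≤-reflexive moves))
    where
    v₀ = Fin.fromℕ< r+1<N
    stay : ∀ v → v ≢ v₀ → frontPotential r ℕ.≤ frontPotential (advance r v)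
    stay v v≢v₀ with toℕ v ℕ.≟ suc r
    ... | yes v≡r+1 = ⊥-elim (v≢v₀ (Finₚ.toℕ-injective (trans v≡r+1 (sym (Finₚ.toℕ-fromℕ< r+1<N)))))
    ... | no _      = ℕₚ.≤-refl
    moves : frontPotential r ≡ frontPotential (advance r v₀) ℕ.+ N
    moves with toℕ v₀ ℕ.≟ suc r
    ... | yes _       = frontPotential-suc r+1<N
    ... | no v₀≢r+1   = ⊥-elim (v₀≢r+1 (Finₚ.toℕ-fromℕ< r+1<N))

  frontState-absorbed : ∀ {r f} → FrontState r f → absorbing G f ≡ true → frontPotential r ≡ 0
  frontState-absorbed {r} (1≤r , r<N , ones) f-abs with suc r ℕ.<? N
  ... | yes r+1<N = ⊥-elim (true≢false (trans (sym f-abs) (onesUpTo-live 1≤r r+1<N ones)))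
  ... | no r+1≮N = begin
    N ℕ.* (N ℕ.∸ suc r)  ≡⟨ cong (λ t → N ℕ.* (N ℕ.∸ t)) r+1≡N ⟩
    N ℕ.* (N ℕ.∸ N)      ≡⟨ cong (N ℕ.*_) (ℕₚ.n∸n≡0 N) ⟩
    N ℕ.* 0              ≡⟨ ℕₚ.*-zeroʳ N ⟩
    0                    ∎
    where
    open ≡-Reasoning
    r+1≡N : suc r ≡ N
    r+1≡N = ℕₚ.≤-antisym r<N (ℕₚ.≮⇒≥ r+1≮N)

  frontState-drift : ∀ {r f} → FrontState r f → absorbing G f ≡ false →
    Σ (Fin N → ℕ) λ next → (∀ v → FrontState (next v) (update G f v)) ×
      N ℕ.* frontPotential r ℕ.≤ N ℕ.+ sum (map (frontPotential ∘ next) (allVerts N))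
  frontState-drift {r} s@(1≤r , r<N , ones) f-live with suc r ℕ.<? N
  ... | yes r+1<N = advance r , frontState-update s r+1<N , frontPotential-drift r+1<N
  ... | no r+1≮N = ⊥-elim (true≢false
    (trans (sym (onesUpTo-absorbing ones (ℕₚ.≤-antisym r<N (ℕₚ.≮⇒≥ r+1≮N)))) f-live))

  twoOnes : Val N
  twoOnes zero          = one
  twoOnes (suc zero)    = one
  twoOnes (suc (suc _)) = zero

  twoOnes-onesUpTo : OnesUpTo 1 twoOnes
  twoOnes-onesUpTo zero          = (λ _ → refl) , λ ()
  twoOnes-onesUpTo (suc zero)    = (λ _ → refl) , λ { (ℕ.s≤s ()) }
  twoOnes-onesUpTo (suc (suc _)) = (λ { (ℕ.s≤s ()) }) , λ _ → refl

  twoOnes-lowerBound : let D = N ℕ.* (N ℕ.∸ 2) in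
    toℚ D ≤ expTrunc G D twoOnes + expTrunc G D twoOnes
  twoOnes-lowerBound = +-cancelʳ-≤ (subst (_≤ (E + E) + toℚ D) (toℚ-+ D D)
    (expTrunc-≥-potential G FrontState frontPotential D
      (λ (1≤r , _) → ℕₚ.*-monoʳ-≤ N (ℕₚ.∸-monoʳ-≤ N (ℕ.s≤s 1≤r)))
      frontState-absorbed frontState-drift D ℕₚ.≤-refl
      (ℕₚ.≤-refl , ℕ.s≤s (ℕ.s≤s ℕ.z≤n) , twoOnes-onesUpTo)))
    where
    D = N ℕ.* (N ℕ.∸ 2)
    E = expTrunc G D twoOnes

P-upperBound : ∀ {n} → 1 ℕ.≤ n → ∀ (f : Val n) k → expTrunc (P n) k f ≤ 1ℚ * (+ (n ℕ.* n) / 1)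
P-upperBound {suc m} _ f k = begin
  expTrunc (P (suc m)) k f        ≤⟨ expTrunc-≤-square (P (suc m)) (P-connected (suc m)) k f ⟩
  toℚ (suc m ℕ.* suc m)           ≡⟨ toℚ-≡ (suc m ℕ.* suc m) ⟩
  + (suc m ℕ.* suc m) / 1         ≡⟨ ℚₚ.*-identityˡ (+ (suc m ℕ.* suc m) / 1) ⟨
  1ℚ * (+ (suc m ℕ.* suc m) / 1)  ∎
  where open ℚₚ.≤-Reasoning

¼ : ℚ
¼ = + 1 / 4

P-lowerBound : ∀ {n} → 4 ℕ.≤ n → ∃ λ (f : Val n) → ∀ (ε : ℚ) → 0ℚ < ε →
  ∃ λ (k : ℕ) → ¼ * (+ (n ℕ.* n) / 1) - ε < expTrunc (P n) k f
P-lowerBound {suc (suc (suc (suc j)))} (ℕ.s≤s (ℕ.s≤s (ℕ.s≤s (ℕ.s≤s _)))) =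
  twoOnes m , λ ε ε>0 → D , (begin-strict
  ¼ * (+ (n ℕ.* n) / 1) - ε       <⟨ ℚₚ.+-monoʳ-< (¼ * (+ (n ℕ.* n) / 1)) (ℚₚ.neg-antimono-< ε>0) ⟩
  ¼ * (+ (n ℕ.* n) / 1) + 0ℚ      ≡⟨ ℚₚ.+-identityʳ (¼ * (+ (n ℕ.* n) / 1)) ⟩
  ¼ * (+ (n ℕ.* n) / 1)           ≡⟨ cong (¼ *_) (toℚ-≡ (n ℕ.* n)) ⟨
  ¼ * toℚ (n ℕ.* n)               ≤⟨ ℚₚ.*-monoˡ-≤-nonNeg ¼ n²≤4E ⟩
  ¼ * ((E + E) + (E + E))         ≡⟨ quarter E ⟩
  E                               ∎)
  where
  open ℚₚ.≤-Reasoning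
  m = suc (suc j)
  n = suc (suc m)
  D = n ℕ.* (n ℕ.∸ 2)
  E = expTrunc (P n) D (twoOnes m)
  n²≤4E : toℚ (n ℕ.* n) ≤ (E + E) + (E + E)
  n²≤4E = begin
    toℚ (n ℕ.* n)        ≤⟨ toℚ-mono-≤ (subst (n ℕ.* n ℕ.≤_) (ℕₚ.*-distribˡ-+ n m m)
                              (ℕₚ.*-monoʳ-≤ n (ℕ.s≤s (ℕ.s≤s (ℕₚ.m≤n+m m j))))) ⟩
    toℚ (D ℕ.+ D)        ≡⟨ toℚ-+ D D ⟩
    toℚ D + toℚ D        ≤⟨ ℚₚ.+-mono-≤ (twoOnes-lowerBound m) (twoOnes-lowerBound m) ⟩
    (E + E) + (E + E)    ∎
  quarter : ∀ e → ¼ * ((e + e) + (e + e)) ≡ e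
  quarter = solve 1 (λ e → con ¼ :* ((e :+ e) :+ (e :+ e)) := e) refl
    where open +-*-Solver

mainTheorem3 :
    Σ ℚ λ c → Σ ℚ λ C → 0ℚ < c × 0ℚ < C × Σ ℕ λ N →
      ∀ (n : ℕ) → N ℕ.≤ n →
        (∃ λ (f : Val n) → ∀ (ε : ℚ) → 0ℚ < ε →
           ∃ λ (k : ℕ) → c * (+ (n ℕ.* n) / 1) - ε < expTrunc (P n) k f)
        × (∀ (f : Val n) (k : ℕ) → expTrunc (P n) k f ≤ C * (+ (n ℕ.* n) / 1))
mainTheorem3 = ¼ , 1ℚ , *<* (ℤ.+<+ (ℕ.s≤s ℕ.z≤n)) , *<* (ℤ.+<+ (ℕ.s≤s ℕ.z≤n)) , 4 ,
  λ n 4≤n → P-lowerBound 4≤n , P-upperBound (ℕₚ.≤-trans (ℕ.s≤s ℕ.z≤n) 4≤n)
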